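{- There are no set $\Pi$ of pure axioms and set $\mathrm P$ of existential saturation rules such that $\mathsf{HXP}+\Pi+\mathrm P$ is strongly complete for $\mathfrak C_{tree}$ (i.e., such that $\Gamma\models_{\mathfrak C_{tree}}\varphi$ implies $\Gamma\vdash_{\mathsf{HXP}+\Pi+\mathrm P}\varphi$ for all sets $\Gamma\cup\{\varphi\}$ of node expressions).
   Context: Mono-modal setting: countable $\mathsf{Prop}$, a countably infinite set $\mathsf{Nom}$ of nominals disjoint from $\mathsf{Prop}$, one modal symbol $\mathsf a$, one equality symbol (written $=,\neq$). Path expressions $\alpha::=\mathsf a\mid @_i\mid[\varphi]\mid\alpha\beta$; node expressions $\varphi::=p\mid i\mid\neg\varphi\mid\varphi\wedge\psi\mid\langle\alpha=\beta\rangle\mid\langle\alpha\neq\beta\rangle$; $*$ is $=$ or $\neq$. Abbreviations: usual Booleans; $\top:=p\vee\neg p$; $\bot:=\neg\top$; $\epsilon:=[\top]$; $\langle\alpha\rangle\varphi:=\langle\alpha[\varphi]=\alpha[\varphi]\rangle$; $[\alpha]\varphi:=\neg\langle\alpha\rangle\neg\varphi$; $@_i\varphi:=\langle @_i\rangle\varphi$. Pure = no propositional symbols. Models $\mathcal M=\langle M,\sim,R_{\mathsf a},V,\mathit{nom}\rangle$ ($\sim$ equivalence relation, $R_{\mathsf a}\subseteq M^2$, $V:M\to2^{\mathsf{Prop}}$, $\mathit{nom}:\mathsf{Nom}\to M$); semantics: $m,n\models\mathsf a$ iff $mR_{\mathsf a}n$; $m,n\models@_i$ iff $\mathit{nom}(i)=n$;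 $m,n\models[\varphi]$ iff $m=n$ and $m\models\varphi$; $m,n\models\alpha\beta$ iff some $l$ with $m,l\models\alpha$, $l,n\models\beta$; $m\models p$ iff $p\in V(m)$; $m\models i$ iff $\mathit{nom}(i)=m$; Booleans usual; $m\models\langle\alpha=\beta\rangle$ (resp. $\neq$) iff there are $n,l$ with $m,n\models\alpha$, $m,l\models\beta$, $n\sim l$ (resp. not). $\Gamma\models_{\mathfrak C}\varphi$: every point of every model of $\mathfrak C$ satisfying $\Gamma$ satisfies $\varphi$. $\mathfrak C_{tree}$: models with a unique point without $R_{\mathsf a}$-predecessor (root), every point reachable from the root in $\ge0$ steps, every point with at most one predecessor, no point reachable from itself in $\ge1$ steps. $\mathsf{HXP}$ (schemes): propositional tautologies, modus ponens; $[\alpha](\varphi\to\psi)\to([\alpha]\varphi\to[\alpha]\psi)$; Nec: $\vdash\varphi\Rightarrow\vdash[\alpha]\varphi$; name: $\vdash @_j\varphi\Rightarrow\vdash\varphi$ ($j$ not in $\varphi$); paste: $\vdash @_i\langle\mathsf a\rangle j\wedge\langle @_j\alpha*\beta\rangle\to\theta\Rightarrow\vdash\langle @_i\mathsf a\alpha*\beta\rangle\to\theta$ ($j\neq i$, not in $\alpha,\beta,\theta$); axioms $\neg @_i\varphi\leftrightarrow @_i\neg\varphi$; $i\to(\varphi\leftrightarrow @_i\varphi)$; $@_ii$; $\langle @_j@_i\alpha*\beta\rangle\leftrightarrow\langle @_i\alpha*\beta\rangle$; $\langle\gamma @_i\alpha*\beta\rangle\to\langle @_i\alpha*\beta\rangle$;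 $\langle(\alpha\beta)\gamma*\eta\rangle\leftrightarrow\langle\alpha(\beta\gamma)*\eta\rangle$; $\langle\alpha\beta*\gamma\rangle\leftrightarrow\langle\alpha\epsilon\beta*\gamma\rangle$ ($\alpha$ or $\beta$ may be empty); $\langle\alpha\beta\rangle\varphi\leftrightarrow\langle\alpha\rangle\langle\beta\rangle\varphi$; $\langle\epsilon=\epsilon\rangle$; $\neg\langle\epsilon\neq\epsilon\rangle$; $\neg\langle @_i=@_j\rangle\leftrightarrow\langle @_i\neq@_j\rangle$; $\langle\epsilon=\alpha\rangle\wedge\langle\epsilon=\beta\rangle\to\langle\alpha=\beta\rangle$; $\langle\alpha*\beta\rangle\leftrightarrow\langle\beta*\alpha\rangle$; $\langle[\varphi]\alpha*\beta\rangle\leftrightarrow\varphi\wedge\langle\alpha*\beta\rangle$; $\langle @_i\alpha*@_i\beta\rangle\to @_i\langle\alpha*\beta\rangle$; $\langle\alpha\beta*\gamma\rangle\to\langle\alpha\rangle\top$; $\langle\alpha\rangle\langle\beta*\gamma\rangle\to\langle\alpha\beta*\alpha\gamma\rangle$. An existential saturation rule has a pure head $\varphi$ with nominals split into $i_1..i_n$ and $j_1..j_m$: from $\vdash\varphi\to\psi$ infer $\vdash\psi$ provided $j_1..j_m$ do not occur in $\psi$. $\mathsf{HXP}+\Pi+\mathrm P$ adds $\Pi$ as axioms and $\mathrm P$ as rules; $\Gamma\vdash\varphi$ iff $\vdash\bigwedge\Gamma'\to\varphi$ for some finite $\Gamma'\subseteq\Gamma$. -}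

module Defs where

open import Level using (0ℓ)
open import Data.Nat using (ℕ)
open import Data.Bool using (Bool; true; false; not; _∧_)
open import Data.List using (List; []; _∷_)
open import Data.List.Relation.Unary.All using (All)
open import Data.Product using (Σ; _×_; _,_)
open import Data.Empty using (⊥)
open import Data.Unit using (⊤)
open import Relation.Nullary using (¬_)
open import Relation.Binary.PropositionalEquality using (_≡_; _≢_)
open import Relation.Binary.Structures using (IsEquivalence)
open import Relation.Binary.Construct.Closure.ReflexiveTransitive using (Star)
open import Relation.Binary.Construct.Closure.Transitive using (TransClosure)

-- Signature: Prop = ℕ, Nom = ℕ (kept disjoint by distinct constructors),
-- a single modal symbol a, a single equality symbol.

PropSym : Set
PropSym = ℕ

Nom : Set
Nom = ℕ

data Cmp : Set where
  EQ NEQ : Cmp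

mutual
  data Path : Set where
    𝐚    : Path
    at   : Nom → Path
    test : Node → Path
    _·_  : Path → Path → Path

  data Node : Set where
    prop : PropSym → Node
    nom  : Nom → Node
    ~_   : Node → Node
    _&_  : Node → Node → Node
    ⟨_⋆_,_⟩ : Path → Cmp → Path → Node

infixr 30 _·_
infix  50 ~_
infixr 40 _&_

⟨_==_⟩ : Path → Path → Node
⟨ α == β ⟩ = ⟨ α ⋆ EQ , β ⟩

⟨_=/=_⟩ : Path → Path → Node
⟨ α =/= β ⟩ = ⟨ α ⋆ NEQ , β ⟩

infixr 35 _∨'_
infixr 32 _⇒_
infix  31 _⇔_

_∨'_ : Node → Node → Node
φ ∨' ψ = ~ (~ φ & ~ ψ)

_⇒_ : Node → Node → Node
φ ⇒ ψ = ~ (φ & ~ ψ)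

_⇔_ : Node → Node → Node
φ ⇔ ψ = (φ ⇒ ψ) & (ψ ⇒ φ)

𝐓 : Node
𝐓 = prop 0 ∨' ~ prop 0

𝐅 : Node
𝐅 = ~ 𝐓

ε : Path
ε = test 𝐓

dia : Path → Node → Node
dia α φ = ⟨ α · test φ == α · test φ ⟩

box : Path → Node → Node
box α φ = ~ dia α (~ φ)

atN : Nom → Node → Node
atN i φ = dia (at i) φ

⋀ : List Node → Node
⋀ []       = 𝐓
⋀ (φ ∷ []) = φ
⋀ (φ ∷ φs) = φ & ⋀ φs

mutual
  PureP : Path → Set
  PureP 𝐚        = ⊤
  PureP (at i)   = ⊤
  PureP (test φ) = PureN φ
  PureP (α · β)  = PureP α × PureP β

  PureN : Node → Set
  PureN (prop p)      = ⊥
  PureN (nom i)       = ⊤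
  PureN (~ φ)         = PureN φ
  PureN (φ & ψ)       = PureN φ × PureN ψ
  PureN ⟨ α ⋆ c , β ⟩ = PureP α × PureP β

mutual
  OccP : Nom → Path → Set
  OccP j 𝐚        = ⊥
  OccP j (at i)   = j ≡ i
  OccP j (test φ) = OccN j φ
  OccP j (α · β)  = Σ Bool λ { true → OccP j α ; false → OccP j β }

  OccN : Nom → Node → Set
  OccN j (prop p)      = ⊥
  OccN j (nom i)       = j ≡ i
  OccN j (~ φ)         = OccN j φ
  OccN j (φ & ψ)       = Σ Bool λ { true → OccN j φ ; false → OccN j ψ }
  OccN j ⟨ α ⋆ c , β ⟩ = Σ Bool λ { true → OccP j α ; false → OccP j β }

-- Propositional tautologies: φ is (an instance of) a propositional
-- tautology iff it is true under every Boolean assignment to its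
-- Boolean atoms (maximal subformulas not headed by ¬ or ∧).

evalB : (Node → Bool) → Node → Bool
evalB v (~ φ)   = not (evalB v φ)
evalB v (φ & ψ) = evalB v φ ∧ evalB v ψ
evalB v φ       = v φ

Tautology : Node → Set
Tautology φ = (v : Node → Bool) → evalB v φ ≡ true

-- Existential saturation rules: a pure head φ whose nominals are split
-- into i₁..iₙ (the rest) and j₁..jₘ (the list js, all occurring in φ).

record ESRule : Set where
  field
    head     : Node
    headPure : PureN head
    js       : List Nom
    jsInHead : All (λ j → OccN j head) js

open ESRule public

module HXP (Π : Node → Set) (P : ESRule → Set) where

  data ⊢_ : Node → Set where
    taut  : ∀ {φ} → Tautology φ → ⊢ φ
    mp    : ∀ {φ ψ} → ⊢ (φ ⇒ ψ) → ⊢ φ → ⊢ ψ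
    axK   : ∀ α φ ψ → ⊢ (box α (φ ⇒ ψ) ⇒ (box α φ ⇒ box α ψ))
    nec   : ∀ {φ} α → ⊢ φ → ⊢ box α φ
    name  : ∀ {φ} j → ¬ OccN j φ → ⊢ atN j φ → ⊢ φ
    paste : ∀ {i j α β θ} c → j ≢ i → ¬ OccP j α → ¬ OccP j β → ¬ OccN j θ →
            ⊢ ((atN i (dia 𝐚 (nom j)) & ⟨ at j · α ⋆ c , β ⟩) ⇒ θ) →
            ⊢ (⟨ at i · 𝐚 · α ⋆ c , β ⟩ ⇒ θ)
    axAtNeg  : ∀ i φ → ⊢ (~ atN i φ ⇔ atN i (~ φ))
    axAt  : ∀ i φ → ⊢ (nom i ⇒ (φ ⇔ atN i φ))
    axAtSelf : ∀ i → ⊢ atN i (nom i)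
    axAtAt  : ∀ i j α β c → ⊢ (⟨ at j · at i · α ⋆ c , β ⟩ ⇔ ⟨ at i · α ⋆ c , β ⟩)
    axγAt  : ∀ i α β γ c → ⊢ (⟨ γ · at i · α ⋆ c , β ⟩ ⇒ ⟨ at i · α ⋆ c , β ⟩)
    axAss : ∀ α β γ η c → ⊢ (⟨ (α · β) · γ ⋆ c , η ⟩ ⇔ ⟨ α · (β · γ) ⋆ c , η ⟩)
    axε   : ∀ α β γ c → ⊢ (⟨ α · β ⋆ c , γ ⟩ ⇔ ⟨ α · ε · β ⋆ c , γ ⟩)
    axεˡ  : ∀ β γ c → ⊢ (⟨ β ⋆ c , γ ⟩ ⇔ ⟨ ε · β ⋆ c , γ ⟩)
    axεʳ  : ∀ α γ c → ⊢ (⟨ α ⋆ c , γ ⟩ ⇔ ⟨ α · ε ⋆ c , γ ⟩)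
    axComp : ∀ α β φ → ⊢ (dia (α · β) φ ⇔ dia α (dia β φ))
    axRefl : ⊢ ⟨ ε == ε ⟩
    axIrr  : ⊢ (~ ⟨ ε =/= ε ⟩)
    axNomNeq : ∀ i j → ⊢ (~ ⟨ at i == at j ⟩ ⇔ ⟨ at i =/= at j ⟩)
    axTrans  : ∀ α β → ⊢ ((⟨ ε == α ⟩ & ⟨ ε == β ⟩) ⇒ ⟨ α == β ⟩)
    axSym  : ∀ α β c → ⊢ (⟨ α ⋆ c , β ⟩ ⇔ ⟨ β ⋆ c , α ⟩)
    axTest : ∀ φ α β c → ⊢ (⟨ test φ · α ⋆ c , β ⟩ ⇔ (φ & ⟨ α ⋆ c , β ⟩))
    axAtDist : ∀ i α β c → ⊢ (⟨ at i · α ⋆ c , at i · β ⟩ ⇒ atN i ⟨ α ⋆ c , β ⟩)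
    axDef  : ∀ α β γ c → ⊢ (⟨ α · β ⋆ c , γ ⟩ ⇒ dia α 𝐓)
    axDist : ∀ α β γ c → ⊢ (dia α ⟨ β ⋆ c , γ ⟩ ⇒ ⟨ α · β ⋆ c , α · γ ⟩)
    axΠ   : ∀ {φ} → Π φ → ⊢ φ
    esr   : ∀ {ψ} (ρ : ESRule) → P ρ → All (λ j → ¬ OccN j ψ) (js ρ) →
            ⊢ (head ρ ⇒ ψ) → ⊢ ψ

  _⊢'_ : (Node → Set) → Node → Set
  Γ ⊢' φ = Σ (List Node) λ Γ' → All Γ Γ' × (⊢ (⋀ Γ' ⇒ φ))

record Model : Set₁ where
  field
    M     : Set
    _∼_   : M → M → Set
    ∼-equiv : IsEquivalence _∼_
    R     : M → M → Set
    V     : M → PropSym → Set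
    nomV  : Nom → M

module Sem (𝓜 : Model) where
  open Model 𝓜

  mutual
    _,_⊨ₚ_ : M → M → Path → Set
    m , n ⊨ₚ 𝐚       = R m n
    m , n ⊨ₚ at i    = nomV i ≡ n
    m , n ⊨ₚ test φ  = (m ≡ n) × (m ⊨ φ)
    m , n ⊨ₚ (α · β) = Σ M λ l → (m , l ⊨ₚ α) × (l , n ⊨ₚ β)

    _⊨_ : M → Node → Set
    m ⊨ prop p = V m p
    m ⊨ nom i  = nomV i ≡ m
    m ⊨ (~ φ)  = ¬ (m ⊨ φ)
    m ⊨ (φ & ψ) = (m ⊨ φ) × (m ⊨ ψ)
    m ⊨ ⟨ α ⋆ EQ , β ⟩  = Σ M λ n → Σ M λ l → (m , n ⊨ₚ α) × (m , l ⊨ₚ β) × (n ∼ l)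
    m ⊨ ⟨ α ⋆ NEQ , β ⟩ = Σ M λ n → Σ M λ l → (m , n ⊨ₚ α) × (m , l ⊨ₚ β) × ¬ (n ∼ l)

record IsTree (𝓜 : Model) : Set where
  open Model 𝓜
  field
    root        : M
    rootNoPred  : ¬ (Σ M λ m → R m root)
    rootUnique  : ∀ r → ¬ (Σ M λ m → R m r) → r ≡ root
    reachable   : ∀ m → Star R root m
    onePred     : ∀ m n k → R n m → R k m → n ≡ k
    acyclic     : ∀ m → ¬ TransClosure R m m

_⊨tree_ : (Node → Set) → Node → Set₁
Γ ⊨tree φ = (𝓜 : Model) → IsTree 𝓜 → (m : Model.M 𝓜) →
            (∀ ψ → Γ ψ → Sem._⊨_ 𝓜 m ψ) → Sem._⊨_ 𝓜 m φ

PureSet : (Node → Set) → Set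
PureSet Π = ∀ φ → Π φ → PureN φ

SoundStronglyCompleteTree : (Node → Set) → (ESRule → Set) → Set₁
SoundStronglyCompleteTree Π P =
  ∀ (Γ : Node → Set) (φ : Node) →
    (HXP._⊢'_ Π P Γ φ → Γ ⊨tree φ) × (Γ ⊨tree φ → HXP._⊢'_ Π P Γ φ)

{-# OPTIONS --safe #-}
module Submission where

open import Defs
open import Level using (0ℓ)
open import Function using (id)
open import Data.Product using (Σ; _×_; _,_; proj₁; proj₂)
open import Relation.Nullary using (¬_)
open import Axiom.ExcludedMiddle using (ExcludedMiddle)
open import Data.Nat using (ℕ; zero; suc; _∸_; _<_; _⊔_)
open import Data.Nat.Properties
  using (suc-injective; +-∸-assoc; <-trans; <-irrefl; n<1+n; m≤m⊔n; m≤n⊔m; <-≤-trans)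
open import Data.List using (List; []; _∷_)
open import Data.List.Relation.Unary.All using (All; []; _∷_)
import Data.List.Relation.Unary.All as All
open import Data.List.Membership.Propositional using (_∈_)
open import Data.Empty using (⊥; ⊥-elim)
open import Relation.Binary.PropositionalEquality using (_≡_; refl; sym; trans; subst; isEquivalence)
open import Relation.Binary.Structures using (IsEquivalence)
open import Relation.Binary.Construct.Closure.ReflexiveTransitive using (Star; _◅_; _◅◅_) renaming (ε to nil)
open import Relation.Binary.Construct.Closure.Transitive using (TransClosure; [_]; _∷_)

-- Strong completeness turns the logic compact over trees.  The set of links
-- @_{n+1}⟨a⟩n describes an infinite backward a-chain, which no tree has since
-- every point is reached from the root in finitely many steps; yet any finitely
-- many links hold in the successor tree on ℕ, with nominal k named at N ∸ k.

module _ {Π : Node → Set} {P : ESRule → Set} where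
  open HXP Π P

  ⊨tree-compact : SoundStronglyCompleteTree Π P → ∀ Γ φ → Γ ⊨tree φ →
                  Σ (List Node) λ Γ' → All Γ Γ' × ((_∈ Γ') ⊨tree φ)
  ⊨tree-compact sc Γ φ Γ⊨φ with proj₂ (sc Γ φ) Γ⊨φ
  ... | Γ' , Γ'⊆Γ , ⊢Γ'⇒φ =
    Γ' , Γ'⊆Γ , proj₁ (sc (_∈ Γ') φ) (Γ' , All.tabulate id , ⊢Γ'⇒φ)

module _ (𝓜 : Model) where
  open Model 𝓜
  open Sem 𝓜

  ⊨𝐓 : ∀ m → m ⊨ 𝐓
  ⊨𝐓 m (¬p , ¬¬p) = ¬¬p ¬p

  ⊨atN-dia𝐚⇒R : ∀ {m i j} → m ⊨ atN i (dia 𝐚 (nom j)) → R (nomV i) (nomV j)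
  ⊨atN-dia𝐚⇒R (_ , _ , (_ , refl , refl , (_ , _ , (_ , r , refl , refl) , _ , _)) , _ , _) = r

  R⇒⊨atN-dia𝐚 : ∀ {i j} → R (nomV i) (nomV j) → ∀ m → m ⊨ atN i (dia 𝐚 (nom j))
  R⇒⊨atN-dia𝐚 {i} {j} r m = x , x , ⊨path , ⊨path , ∼-refl
    where
    open IsEquivalence ∼-equiv renaming (refl to ∼-refl)
    x = nomV i
    y = nomV j
    ⊨⟨a⟩j : x ⊨ dia 𝐚 (nom j)
    ⊨⟨a⟩j = y , y , (y , r , refl , refl) , (y , r , refl , refl) , ∼-refl
    ⊨path : m , x ⊨ₚ at i · test (dia 𝐚 (nom j))
    ⊨path = x , refl , refl , ⊨⟨a⟩j

module _ (𝓜 : Model) (T : IsTree 𝓜) where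
  open Model 𝓜
  open IsTree T

  backwardChain-reaches : (x : ℕ → M) → (∀ n → R (x (suc n)) (x n)) →
                          ∀ {a} → Star R a (x 0) → Σ ℕ λ k → x k ≡ a
  backwardChain-reaches x chain = go refl
    where
    go : ∀ {a m} → x 0 ≡ m → Star R a m → Σ ℕ λ k → x k ≡ a
    go e nil = 0 , e
    go e (_◅_ {j = b} r s) with go e s
    ... | k , xk≡b = suc k , onePred b (x (suc k)) _ (subst (R (x (suc k))) xk≡b (chain k)) r

  ¬backwardChain : (x : ℕ → M) → ¬ (∀ n → R (x (suc n)) (x n))
  ¬backwardChain x chain with backwardChain-reaches x chain (reachable (x 0))
  ... | k , xk≡root = rootNoPred (x (suc k) , subst (R (x (suc k))) xk≡root (chain k))

chainLink : ℕ → Node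
chainLink n = atN (suc n) (dia 𝐚 (nom n))

ChainLink : Node → Set
ChainLink φ = Σ ℕ λ n → φ ≡ chainLink n

ChainLink⊨𝐅 : ChainLink ⊨tree 𝐅
ChainLink⊨𝐅 𝓜 T m ⊨links _ =
  ¬backwardChain 𝓜 T (Model.nomV 𝓜) (λ n → ⊨atN-dia𝐚⇒R 𝓜 {m} (⊨links _ (n , refl)))

ChainLinkBelow : ℕ → Node → Set
ChainLinkBelow N φ = Σ ℕ λ n → n < N × φ ≡ chainLink n

ChainLinks-bounded : ∀ {φs} → All ChainLink φs → Σ ℕ λ N → All (ChainLinkBelow N) φs
ChainLinks-bounded [] = 0 , []
ChainLinks-bounded ((n , e) ∷ links) with ChainLinks-bounded links
... | N , below =
  suc n ⊔ N , (n , <-≤-trans (n<1+n n) (m≤m⊔n (suc n) N) , e)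
            ∷ All.map (λ { (k , k<N , e′) → k , <-≤-trans k<N (m≤n⊔m (suc n) N) , e′ }) below

_→ℕ_ : ℕ → ℕ → Set
m →ℕ n = n ≡ suc m

successorModel : (Nom → ℕ) → Model
successorModel ν = record
  { M = ℕ ; _∼_ = _≡_ ; ∼-equiv = isEquivalence ; R = _→ℕ_
  ; V = λ _ _ → ⊥ ; nomV = ν }

successorModel-isTree : ∀ ν → IsTree (successorModel ν)
successorModel-isTree ν = record
  { root = 0
  ; rootNoPred = λ { (_ , ()) }
  ; rootUnique = λ { zero _ → refl ; (suc k) noPred → ⊥-elim (noPred (k , refl)) }
  ; reachable = reachable
  ; onePred = λ _ _ _ p q → suc-injective (trans (sym p) q)
  ; acyclic = λ m t → <-irrefl refl (→ℕ⁺⇒< t) }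
  where
  reachable : ∀ m → Star _→ℕ_ 0 m
  reachable zero = nil
  reachable (suc m) = reachable m ◅◅ (refl ◅ nil)

  →ℕ⁺⇒< : ∀ {a b} → TransClosure _→ℕ_ a b → a < b
  →ℕ⁺⇒< [ refl ] = n<1+n _
  →ℕ⁺⇒< (refl ∷ t) = <-trans (n<1+n _) (→ℕ⁺⇒< t)

countdown : ℕ → Model
countdown N = successorModel (N ∸_)

countdown⊨ChainLinkBelow : ∀ {N φ} → ChainLinkBelow N φ → ∀ m → Sem._⊨_ (countdown N) m φ
countdown⊨ChainLinkBelow {N} (n , n<N , refl) =
  R⇒⊨atN-dia𝐚 (countdown N) {suc n} {n} (+-∸-assoc 1 n<N)

-- The argument is constructive and works for any Π and P.
corollary4p4 : ExcludedMiddle 0ℓ →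
    ¬ (Σ (Node → Set) λ Π → Σ (ESRule → Set) λ P →
         PureSet Π × SoundStronglyCompleteTree Π P)
corollary4p4 _ (_ , _ , _ , sc) with ⊨tree-compact sc ChainLink 𝐅 ChainLink⊨𝐅
... | Γ' , links , Γ'⊨𝐅 with ChainLinks-bounded links
... | N , below =
  Γ'⊨𝐅 (countdown N) (successorModel-isTree (N ∸_)) 0
        (λ _ φ∈Γ' → countdown⊨ChainLinkBelow (All.lookup below φ∈Γ') 0)
        (⊨𝐓 (countdown N) 0)
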